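{- Let $k\ge2$ and let $a_1,\ldots,a_k$ be positive integers. Then \[ \mathcal N[a_2,\ldots,a_{k-1},a_k+1,a_k,a_{k-1},\ldots,a_1]=\mathcal N[a_1,\ldots,a_{k-1},a_k+1,a_k,a_{k-1},\ldots,a_2]+c_k, \] where $c_k=1$ if $k$ is even and $c_k=-1$ if $k$ is odd.
   Context: For positive integers $b_1,\ldots,b_n$, the continued fraction is $[b_1,\ldots,b_n]=b_1+\cfrac{1}{b_2+\cfrac{1}{\ddots+\cfrac{1}{b_n}}}$. $\mathcal N[b_1,\ldots,b_n]$ denotes its numerator when written in lowest terms, with $\mathcal N[\,]=1$. -}

module Defs where

open import Data.Nat using (ℕ; zero; suc; _+_; _∸_)
open import Data.Integer using (ℤ; +_; -_)
open import Data.List using (List; []; _∷_; map; upTo; reverse)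
open import Data.Rational using (ℚ; ↥_; 0ℚ; 1/_; _/_)
import Data.Rational as ℚ
open import Data.Rational.Properties using (_≟_)
open import Relation.Nullary using (yes; no)
open import Relation.Nullary.Negation using (contradiction)

-- Reciprocal, totalised at 0 (the value at 0 never matters below: with
-- positive partial quotients every tail value is ≥ 1).
inv : ℚ → ℚ
inv p with p ≟ 0ℚ
... | yes _ = 0ℚ
... | no p≢0 = 1/_ p {{ℚ.≢-nonZero p≢0}}

cfVal : ℕ → List ℕ → ℚ
cfVal b []       = + b / 1
cfVal b (c ∷ cs) = (+ b / 1) ℚ.+ inv (cfVal c cs)

𝒩 : List ℕ → ℤ
𝒩 []       = + 1
𝒩 (b ∷ bs) = ↥ (cfVal b bs)

-- [a i , a (i+1) , … , a j]  (empty if j < i)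
ascending : (ℕ → ℕ) → ℕ → ℕ → List ℕ
ascending a i j = map (λ t → a (i + t)) (upTo (suc j ∸ i))

descending : (ℕ → ℕ) → ℕ → ℕ → List ℕ
descending a i j = reverse (ascending a i j)

c : ℕ → ℤ
c zero          = + 1
c (suc zero)    = - (+ 1)
c (suc (suc k)) = c k

-- With positive partial quotients, 𝒩[b₁,…,bₙ] is the continuant K(b₁,…,bₙ): the
-- top-left entry of the product of the matrices [[bᵢ,1],[1,0]], whose first column
-- (K, K′) consists of coprime numbers, so the fraction K/K′ is already reduced.
-- Let W be the matrix of a₂,…,a_{k-1}, B that of (a_k+1, a_k) and M = W·B·Wᵀ.
-- The two sides are the top-left entries of M·A(a₁) and A(a₁)·M, which differ by
-- M₁₂ − M₂₁. This skew part is multiplied by det W = (−1)^(k−2) under the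
-- congruence B ↦ W·B·Wᵀ, and for B it is (a_k+1) − a_k = 1.

module Submission where

open import Defs
open import Data.Nat using (ℕ; zero; suc; _∸_; _+_; _≤_; _<_; s≤s; z≤n; NonZero)
import Data.Nat as ℕ
import Data.Nat.Properties as ℕ
open import Data.Nat.Coprimality as Coprime using (Coprime)
open import Data.Nat.Divisibility using (∣m+n∣m⇒∣n; ∣n⇒∣m*n)
open import Data.Integer using (ℤ; +_; _*_; _-_)
import Data.Integer as ℤ
import Data.Integer.Properties as ℤ
open import Data.Integer.Tactic.RingSolver using (solve-∀)
open import Data.Rational using (mkℚ+; ↥_; 0ℚ; _/_)
import Data.Rational as ℚ
import Data.Rational.Properties as ℚ
open import Data.List using (List; []; _∷_; _++_; _∷ʳ_; map; upTo; applyUpTo; reverse; length)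
import Data.List.Properties as List
open import Data.List.Relation.Unary.All using (All; []; _∷_)
import Data.List.Relation.Unary.All.Properties as All
open import Data.List.Relation.Binary.Permutation.Propositional using (↭-sym)
open import Data.List.Relation.Binary.Permutation.Propositional.Properties using (All-resp-↭; ↭-reverse)
open import Data.Product using (_×_; _,_; proj₁)
open import Function using (id)
open import Relation.Nullary using (yes; no)
open import Relation.Binary.PropositionalEquality using (_≡_; refl; sym; trans; subst; cong; cong₂; module ≡-Reasoning)

-- K′ l is the continuant of the tail of l, with K′ [] = 0 (the usual K₋₁ = 0).
K K′ : List ℕ → ℕ
K []      = 1
K (x ∷ l) = x ℕ.* K l ℕ.+ K′ l
K′ []      = 0
K′ (x ∷ l) = K l

K-nonZero : ∀ {l} → All (0 <_) l → NonZero (K l)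
K-nonZero []                   = _
K-nonZero {suc x ∷ l} (_ ∷ ps) with K l | K-nonZero ps
... | suc _ | _ = _

K-coprime : ∀ l → Coprime (K l) (K′ l)
K-coprime []      = Coprime.1-coprimeTo 0
K-coprime (x ∷ l) (d∣K , d∣K′) = K-coprime l (d∣K′ , ∣m+n∣m⇒∣n d∣K (∣n⇒∣m*n x d∣K′))

inv-mkℚ+ : ∀ n d .{{_ : NonZero n}} .{{_ : NonZero d}} .(n⊥d : Coprime n d) →
           inv (mkℚ+ n d n⊥d) ≡ mkℚ+ d n (Coprime.sym n⊥d)
inv-mkℚ+ (suc n) (suc d) n⊥d with mkℚ+ (suc n) (suc d) n⊥d ℚ.≟ 0ℚ
... | yes ()
... | no _  = refl

n/1+mkℚ+ : ∀ b n d .{{_ : NonZero d}} .(n⊥d : Coprime n d) .(m⊥d : Coprime (b ℕ.* d ℕ.+ n) d) →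
           + b / 1 ℚ.+ mkℚ+ n d n⊥d ≡ mkℚ+ (b ℕ.* d ℕ.+ n) d m⊥d
n/1+mkℚ+ b n d@(suc _) n⊥d m⊥d = begin
  + b / 1 ℚ.+ mkℚ+ n d n⊥d                 ≡⟨ cong (ℚ._+ mkℚ+ n d n⊥d) (ℚ.normalize-coprime (Coprime.sym (Coprime.1-coprimeTo b))) ⟩
  (+ b * + d ℤ.+ + n * + 1) / (1 ℕ.* d)   ≡⟨ ℚ./-cong numerator (ℕ.*-identityˡ d) ⟩
  + (b ℕ.* d ℕ.+ n) / d                    ≡⟨ ℚ.normalize-coprime m⊥d ⟩
  mkℚ+ (b ℕ.* d ℕ.+ n) d m⊥d               ∎
  where
  open ≡-Reasoning
  numerator : + b * + d ℤ.+ + n * + 1 ≡ + (b ℕ.* d ℕ.+ n)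
  numerator = begin
    + b * + d ℤ.+ + n * + 1  ≡⟨ cong₂ ℤ._+_ (sym (ℤ.pos-* b d)) (ℤ.*-identityʳ (+ n)) ⟩
    + (b ℕ.* d) ℤ.+ + n      ≡⟨ sym (ℤ.pos-+ (b ℕ.* d) n) ⟩
    + (b ℕ.* d ℕ.+ n)        ∎

cfVal-continuant : ∀ b l (ps : All (0 <_) l) →
  cfVal b l ≡ mkℚ+ (K (b ∷ l)) (K l) {{K-nonZero ps}} (K-coprime (b ∷ l))
cfVal-continuant b []       []         = trans (ℚ.normalize-coprime (Coprime.sym (Coprime.1-coprimeTo b))) (ℚ.mkℚ-cong (cong +_ (sym b*1+0≡b)) refl)
  where
  b*1+0≡b : b ℕ.* 1 ℕ.+ 0 ≡ b
  b*1+0≡b = trans (ℕ.+-identityʳ (b ℕ.* 1)) (ℕ.*-identityʳ b)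
cfVal-continuant b (x ∷ l) ps@(_ ∷ ps′) = begin
  + b / 1 ℚ.+ inv (cfVal x l)                       ≡⟨ cong (λ q → + b / 1 ℚ.+ inv q) (cfVal-continuant x l ps′) ⟩
  + b / 1 ℚ.+ inv (mkℚ+ (K (x ∷ l)) (K l) _)       ≡⟨ cong (+ b / 1 ℚ.+_) (inv-mkℚ+ (K (x ∷ l)) (K l) (K-coprime (x ∷ l))) ⟩
  + b / 1 ℚ.+ mkℚ+ (K l) (K (x ∷ l)) _             ≡⟨ n/1+mkℚ+ b (K l) (K (x ∷ l)) _ (K-coprime (b ∷ x ∷ l)) ⟩
  mkℚ+ (K (b ∷ x ∷ l)) (K (x ∷ l)) _               ∎
  where
  open ≡-Reasoning
  instance
    K[x∷l]≢0 = K-nonZero ps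
    K[l]≢0   = K-nonZero ps′

𝒩-continuant : ∀ {l} → All (0 <_) l → 𝒩 l ≡ + K l
𝒩-continuant []               = refl
𝒩-continuant {b ∷ l} (_ ∷ ps) =
  trans (cong ↥_ (cfVal-continuant b l ps)) (ℚ.↥-mkℚ+ _ _ {{K-nonZero ps}})

record Mat : Set where
  constructor mk
  field m₁₁ m₁₂ m₂₁ m₂₂ : ℤ
open Mat

mk-cong : ∀ {a b c d a′ b′ c′ d′} → a ≡ a′ → b ≡ b′ → c ≡ c′ → d ≡ d′ → mk a b c d ≡ mk a′ b′ c′ d′
mk-cong refl refl refl refl = refl

infixr 7 _⊗_
_⊗_ : Mat → Mat → Mat
mk a b c d ⊗ mk e f g h = mk (a * e ℤ.+ b * g) (a * f ℤ.+ b * h) (c * e ℤ.+ d * g) (c * f ℤ.+ d * h)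

I : Mat
I = mk (+ 1) (+ 0) (+ 0) (+ 1)

transpose : Mat → Mat
transpose (mk a b c d) = mk a c b d

det : Mat → ℤ
det (mk a b c d) = a * d - b * c

skew : Mat → ℤ
skew M = m₁₂ M - m₂₁ M

⊗-assoc : ∀ P Q R → (P ⊗ Q) ⊗ R ≡ P ⊗ (Q ⊗ R)
⊗-assoc (mk a b c d) (mk e f g h) (mk i j k l) =
  mk-cong (entry a b e f g h i k) (entry a b e f g h j l) (entry c d e f g h i k) (entry c d e f g h j l)
  where
  entry : ∀ a b e f g h i k →
    (a * e ℤ.+ b * g) * i ℤ.+ (a * f ℤ.+ b * h) * k ≡ a * (e * i ℤ.+ f * k) ℤ.+ b * (g * i ℤ.+ h * k)
  entry = solve-∀

⊗-identityˡ : ∀ P → I ⊗ P ≡ P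
⊗-identityˡ (mk a b c d) = mk-cong (entry₁ a c) (entry₁ b d) (entry₂ a c) (entry₂ b d)
  where
  entry₁ : ∀ x y → + 1 * x ℤ.+ + 0 * y ≡ x
  entry₁ = solve-∀
  entry₂ : ∀ x y → + 0 * x ℤ.+ + 1 * y ≡ y
  entry₂ = solve-∀

⊗-identityʳ : ∀ P → P ⊗ I ≡ P
⊗-identityʳ (mk a b c d) = mk-cong (entry₁ a b) (entry₂ a b) (entry₁ c d) (entry₂ c d)
  where
  entry₁ : ∀ x y → x * + 1 ℤ.+ y * + 0 ≡ x
  entry₁ = solve-∀
  entry₂ : ∀ x y → x * + 0 ℤ.+ y * + 1 ≡ y
  entry₂ = solve-∀

transpose-⊗ : ∀ P Q → transpose (P ⊗ Q) ≡ transpose Q ⊗ transpose P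
transpose-⊗ (mk a b c d) (mk e f g h) =
  mk-cong (entry a b e g) (entry c d e g) (entry a b f h) (entry c d f h)
  where
  entry : ∀ a b e g → a * e ℤ.+ b * g ≡ e * a ℤ.+ g * b
  entry = solve-∀

det-⊗ : ∀ P Q → det (P ⊗ Q) ≡ det P * det Q
det-⊗ (mk a b c d) (mk e f g h) = identity a b c d e f g h
  where
  identity : ∀ a b c d e f g h →
    (a * e ℤ.+ b * g) * (c * f ℤ.+ d * h) - (a * f ℤ.+ b * h) * (c * e ℤ.+ d * g)
      ≡ (a * d - b * c) * (e * h - f * g)
  identity = solve-∀

skew-congruence : ∀ W B → skew (W ⊗ B ⊗ transpose W) ≡ det W * skew B
skew-congruence (mk a b c d) (mk e f g h) = identity a b c d e f g h
  where
  identity : ∀ a b c d e f g h →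
    a * (e * c ℤ.+ f * d) ℤ.+ b * (g * c ℤ.+ h * d) - (c * (e * a ℤ.+ f * b) ℤ.+ d * (g * a ℤ.+ h * b))
      ≡ (a * d - b * c) * (f - g)
  identity = solve-∀

A : ℕ → Mat
A x = mk (+ x) (+ 1) (+ 1) (+ 0)

matrix : List ℕ → Mat
matrix []      = I
matrix (x ∷ l) = A x ⊗ matrix l

matrix-++ : ∀ l m → matrix (l ++ m) ≡ matrix l ⊗ matrix m
matrix-++ []      m = sym (⊗-identityˡ (matrix m))
matrix-++ (x ∷ l) m = trans (cong (A x ⊗_) (matrix-++ l m)) (sym (⊗-assoc (A x) (matrix l) (matrix m)))

matrix-∷ʳ : ∀ l x → matrix (l ∷ʳ x) ≡ matrix l ⊗ A x
matrix-∷ʳ l x = trans (matrix-++ l (x ∷ [])) (cong (matrix l ⊗_) (⊗-identityʳ (A x)))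

matrix-reverse : ∀ l → matrix (reverse l) ≡ transpose (matrix l)
matrix-reverse []      = refl
matrix-reverse (x ∷ l) = begin
  matrix (reverse (x ∷ l))          ≡⟨ cong matrix (List.unfold-reverse x l) ⟩
  matrix (reverse l ∷ʳ x)           ≡⟨ matrix-∷ʳ (reverse l) x ⟩
  matrix (reverse l) ⊗ A x          ≡⟨ cong (_⊗ A x) (matrix-reverse l) ⟩
  transpose (matrix l) ⊗ A x        ≡⟨ sym (transpose-⊗ (A x) (matrix l)) ⟩
  transpose (A x ⊗ matrix l)        ∎
  where open ≡-Reasoning

c-suc : ∀ n → c (suc n) ≡ ℤ.-1ℤ * c n
c-suc zero          = refl
c-suc (suc zero)    = refl
c-suc (suc (suc n)) = c-suc n

det-matrix : ∀ l → det (matrix l) ≡ c (length l)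
det-matrix []      = refl
det-matrix (x ∷ l) = begin
  det (A x ⊗ matrix l)           ≡⟨ det-⊗ (A x) (matrix l) ⟩
  det (A x) * det (matrix l)     ≡⟨ cong₂ _*_ (det-A (+ x)) (det-matrix l) ⟩
  ℤ.-1ℤ * c (length l)           ≡⟨ sym (c-suc (length l)) ⟩
  c (length (x ∷ l))             ∎
  where
  open ≡-Reasoning
  det-A : ∀ v → v * + 0 - + 1 * + 1 ≡ ℤ.-1ℤ
  det-A = solve-∀

matrix-continuants : ∀ l → m₁₁ (matrix l) ≡ + K l × m₂₁ (matrix l) ≡ + K′ l
matrix-continuants []      = refl , refl
matrix-continuants (x ∷ l) with matrix l | matrix-continuants l
... | mk _ _ _ _ | refl , refl = first-row , first-column
  where
  first-row : + x * + K l ℤ.+ + 1 * + K′ l ≡ + (x ℕ.* K l ℕ.+ K′ l)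
  first-row = begin
    + x * + K l ℤ.+ + 1 * + K′ l  ≡⟨ cong₂ ℤ._+_ (sym (ℤ.pos-* x (K l))) (ℤ.*-identityˡ (+ K′ l)) ⟩
    + (x ℕ.* K l) ℤ.+ + K′ l      ≡⟨ sym (ℤ.pos-+ (x ℕ.* K l) (K′ l)) ⟩
    + (x ℕ.* K l ℕ.+ K′ l)        ∎
    where open ≡-Reasoning
  first-column : + 1 * + K l ℤ.+ + 0 * + K′ l ≡ + K l
  first-column = trans (cong₂ ℤ._+_ (ℤ.*-identityˡ (+ K l)) (ℤ.*-zeroˡ (+ K′ l))) (ℤ.+-identityʳ (+ K l))

m₁₁-⊗-A : ∀ M x → m₁₁ (M ⊗ A x) ≡ m₁₁ (A x ⊗ M) ℤ.+ skew M
m₁₁-⊗-A (mk a b c d) x = identity a b c (+ x)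
  where
  identity : ∀ a b c v → a * v ℤ.+ b * + 1 ≡ v * a ℤ.+ + 1 * c ℤ.+ (b - c)
  identity = solve-∀

K-palindrome : ∀ L P y →
  + K (L ++ P ++ reverse (y ∷ L)) ≡ + K (y ∷ L ++ P ++ reverse L) ℤ.+ c (length L) * skew (matrix P)
K-palindrome L P y = begin
  + K (L ++ P ++ reverse (y ∷ L))                      ≡⟨ sym (proj₁ (matrix-continuants (L ++ P ++ reverse (y ∷ L)))) ⟩
  m₁₁ (matrix (L ++ P ++ reverse (y ∷ L)))             ≡⟨ cong m₁₁ appended ⟩
  m₁₁ (M ⊗ A y)                                        ≡⟨ m₁₁-⊗-A M y ⟩
  m₁₁ (A y ⊗ M) ℤ.+ skew M                             ≡⟨ cong₂ ℤ._+_ (proj₁ (matrix-continuants (y ∷ L ++ P ++ reverse L))) skew-M ⟩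
  + K (y ∷ L ++ P ++ reverse L) ℤ.+ c (length L) * skew (matrix P) ∎
  where
  open ≡-Reasoning
  M : Mat
  M = matrix (L ++ P ++ reverse L)
  appended : matrix (L ++ P ++ reverse (y ∷ L)) ≡ M ⊗ A y
  appended = begin
    matrix (L ++ P ++ reverse (y ∷ L))      ≡⟨ cong (λ r → matrix (L ++ P ++ r)) (List.unfold-reverse y L) ⟩
    matrix (L ++ P ++ (reverse L ∷ʳ y))     ≡⟨ cong matrix (sym (List.++-assoc L P (reverse L ∷ʳ y))) ⟩
    matrix ((L ++ P) ++ reverse L ∷ʳ y)     ≡⟨ cong matrix (sym (List.++-assoc (L ++ P) (reverse L) (y ∷ []))) ⟩
    matrix (((L ++ P) ++ reverse L) ∷ʳ y)   ≡⟨ matrix-∷ʳ ((L ++ P) ++ reverse L) y ⟩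
    matrix ((L ++ P) ++ reverse L) ⊗ A y    ≡⟨ cong (λ l → matrix l ⊗ A y) (List.++-assoc L P (reverse L)) ⟩
    M ⊗ A y                                 ∎
  skew-M : skew M ≡ c (length L) * skew (matrix P)
  skew-M = begin
    skew M                                                        ≡⟨ cong skew (matrix-++ L (P ++ reverse L)) ⟩
    skew (matrix L ⊗ matrix (P ++ reverse L))                     ≡⟨ cong (λ N → skew (matrix L ⊗ N)) (matrix-++ P (reverse L)) ⟩
    skew (matrix L ⊗ matrix P ⊗ matrix (reverse L))               ≡⟨ cong (λ N → skew (matrix L ⊗ matrix P ⊗ N)) (matrix-reverse L) ⟩
    skew (matrix L ⊗ matrix P ⊗ transpose (matrix L))             ≡⟨ skew-congruence (matrix L) (matrix P) ⟩
    det (matrix L) * skew (matrix P)                              ≡⟨ cong (_* skew (matrix P)) (det-matrix L) ⟩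
    c (length L) * skew (matrix P)                                ∎

skew-matrix-[x+1,x] : ∀ x → skew (matrix ((x + 1) ∷ x ∷ [])) ≡ + 1
skew-matrix-[x+1,x] x = begin
  skew (A (x + 1) ⊗ A x ⊗ I)   ≡⟨ cong (λ N → skew (A (x + 1) ⊗ N)) (⊗-identityʳ (A x)) ⟩
  skew (A (x + 1) ⊗ A x)       ≡⟨ skew-A⊗A (+ (x + 1)) (+ x) ⟩
  + (x + 1) - + x              ≡⟨ cong (_- + x) (ℤ.pos-+ x 1) ⟩
  + x ℤ.+ + 1 - + x            ≡⟨ cancel (+ x) ⟩
  + 1                          ∎
  where
  open ≡-Reasoning
  skew-A⊗A : ∀ u v → u * + 1 ℤ.+ + 1 * + 0 - (+ 1 * v ℤ.+ + 0 * + 1) ≡ u - v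
  skew-A⊗A = solve-∀
  cancel : ∀ v → v ℤ.+ + 1 - v ≡ + 1
  cancel = solve-∀

K-palindrome-[x+1,x] : ∀ L x y →
  + K (L ++ (x + 1) ∷ x ∷ reverse (y ∷ L)) ≡ + K (y ∷ L ++ (x + 1) ∷ x ∷ reverse L) ℤ.+ c (length L)
K-palindrome-[x+1,x] L x y = begin
  + K (L ++ P ++ reverse (y ∷ L))                                   ≡⟨ K-palindrome L P y ⟩
  + K (y ∷ L ++ P ++ reverse L) ℤ.+ c (length L) * skew (matrix P)  ≡⟨ cong (λ s → + K (y ∷ L ++ P ++ reverse L) ℤ.+ c (length L) * s) (skew-matrix-[x+1,x] x) ⟩
  + K (y ∷ L ++ P ++ reverse L) ℤ.+ c (length L) * + 1              ≡⟨ cong (λ n → + K (y ∷ L ++ P ++ reverse L) ℤ.+ n) (ℤ.*-identityʳ (c (length L))) ⟩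
  + K (y ∷ L ++ P ++ reverse L) ℤ.+ c (length L)                    ∎
  where
  open ≡-Reasoning
  P : List ℕ
  P = (x + 1) ∷ x ∷ []

ascending-unfold : ∀ a i j → i ≤ j → ascending a i j ≡ a i ∷ ascending a (suc i) j
ascending-unfold a i j i≤j = begin
  map f (upTo (suc j ∸ i))                       ≡⟨ cong (λ n → map f (upTo n)) (ℕ.+-∸-assoc 1 i≤j) ⟩
  f 0 ∷ map f (applyUpTo suc (j ∸ i))            ≡⟨ cong₂ _∷_ (cong a (ℕ.+-identityʳ i)) (List.map-applyUpTo suc f (j ∸ i)) ⟩
  a i ∷ applyUpTo (λ t → f (suc t)) (j ∸ i)     ≡⟨ cong (a i ∷_) (sym (List.map-upTo (λ t → f (suc t)) (j ∸ i))) ⟩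
  a i ∷ map (λ t → f (suc t)) (upTo (j ∸ i))    ≡⟨ cong (a i ∷_) (List.map-cong (λ t → cong a (ℕ.+-suc i t)) (upTo (j ∸ i))) ⟩
  a i ∷ ascending a (suc i) j                    ∎
  where
  open ≡-Reasoning
  f : ℕ → ℕ
  f t = a (i + t)

length-ascending : ∀ a i j → length (ascending a i j) ≡ suc j ∸ i
length-ascending a i j = trans (List.length-map _ (upTo (suc j ∸ i))) (List.length-upTo (suc j ∸ i))

All-ascending : ∀ {P : ℕ → Set} a i j → (∀ t → i ≤ t → t ≤ j → P (a t)) → All P (ascending a i j)
All-ascending a i j P-a = All.map⁺ (All.applyUpTo⁺₁ id (suc j ∸ i) (λ {t} t<n → P-a (i + t) (ℕ.m≤m+n i t) (i+t≤j t<n)))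
  where
  i+t≤j : ∀ {t} → t < suc j ∸ i → i + t ≤ j
  i+t≤j {t} t<n = subst (_≤ j) (ℕ.+-comm t i) (ℕ.s≤s⁻¹ (ℕ.m≤o∸n⇒m+n≤o (suc t) i≤1+j t<n))
    where
    i≤1+j : i ≤ suc j
    i≤1+j = ℕ.<⇒≤ (ℕ.m∸n≢0⇒n<m (ℕ.m<n⇒n≢0 t<n))

All-reverse : ∀ {P : ℕ → Set} {l} → All P l → All P (reverse l)
All-reverse {l = l} = All-resp-↭ (↭-sym (↭-reverse l))

lemma2p13 : (k : ℕ) → 2 ≤ k → (a : ℕ → ℕ) → (∀ i → 1 ≤ i → i ≤ k → 0 < a i) →
    𝒩 (ascending a 2 (k ∸ 1) ++ (a k + 1) ∷ a k ∷ descending a 1 (k ∸ 1))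
      ≡ 𝒩 (ascending a 1 (k ∸ 1) ++ (a k + 1) ∷ a k ∷ descending a 2 (k ∸ 1)) ℤ.+ c k
lemma2p13 k@(suc (suc m)) (s≤s (s≤s _)) a a-positive = begin
  𝒩 (L ++ P ++ reverse A₁)                          ≡⟨ 𝒩-continuant (palindrome-positive L-positive A₁-positive) ⟩
  + K (L ++ P ++ reverse A₁)                        ≡⟨ cong (λ l → + K (L ++ P ++ reverse l)) A₁-unfold ⟩
  + K (L ++ P ++ reverse (a 1 ∷ L))                 ≡⟨ K-palindrome-[x+1,x] L (a k) (a 1) ⟩
  + K (a 1 ∷ L ++ P ++ reverse L) ℤ.+ c (length L)  ≡⟨ cong₂ (λ l n → + K (l ++ P ++ reverse L) ℤ.+ c n) (sym A₁-unfold) (length-ascending a 2 (suc m)) ⟩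
  + K (A₁ ++ P ++ reverse L) ℤ.+ c m                ≡⟨ cong (ℤ._+ c m) (sym (𝒩-continuant (palindrome-positive A₁-positive L-positive))) ⟩
  𝒩 (A₁ ++ P ++ reverse L) ℤ.+ c m                  ∎
  where
  open ≡-Reasoning
  L A₁ P : List ℕ
  L  = ascending a 2 (suc m)
  A₁ = ascending a 1 (suc m)
  P  = (a k + 1) ∷ a k ∷ []
  A₁-unfold : A₁ ≡ a 1 ∷ L
  A₁-unfold = ascending-unfold a 1 (suc m) (s≤s z≤n)
  ascending-positive : ∀ i → 1 ≤ i → All (0 <_) (ascending a i (suc m))
  ascending-positive i 1≤i = All-ascending a i (suc m) (λ t i≤t t≤1+m → a-positive t (ℕ.≤-trans 1≤i i≤t) (ℕ.m≤n⇒m≤1+n t≤1+m))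
  L-positive : All (0 <_) L
  L-positive = ascending-positive 2 (s≤s z≤n)
  A₁-positive : All (0 <_) A₁
  A₁-positive = ascending-positive 1 (s≤s z≤n)
  a-k-positive : 0 < a k
  a-k-positive = a-positive k (s≤s z≤n) ℕ.≤-refl
  palindrome-positive : ∀ {l l′} → All (0 <_) l → All (0 <_) l′ → All (0 <_) (l ++ P ++ reverse l′)
  palindrome-positive l-positive l′-positive =
    All.++⁺ l-positive (ℕ.m≤n⇒m≤n+o 1 a-k-positive ∷ a-k-positive ∷ All-reverse l′-positive)
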